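{- Let $n, l$ be positive integers and let $p$ be a prime such that $p^l$ divides $n$ but $p^{l+1}$ does not divide $n$. Let $S$ be a subset of $\mathbb{Z}_n$ with $0 \notin S$, $S = -S$, and $|S| = p^l - 1$, such that the circulant graph $\mathrm{Cay}(\mathbb{Z}_n, S)$ is connected. Then $\mathrm{Cay}(\mathbb{Z}_n, S)$ admits a perfect code if and only if $s \not\equiv s' \pmod{p^l}$ for all distinct $s, s' \in S \cup \{0\}$.
   Context: For a finite group $G$ and an inverse-closed subset $X \subseteq G$ not containing the identity, the Cayley graph $\mathrm{Cay}(G,X)$ has vertex set $G$, with $u,v$ adjacent iff $vu^{ -1} \in X$. A circulant graph is a Cayley graph $\mathrm{Cay}(\mathbb{Z}_n, S)$ on the additive cyclic group $\mathbb{Z}_n$; its degree is $|S|$. A perfect code in a graph $\Gamma=(V,E)$ is a subset $C \subseteq V$ such that the closed neighbourhoods (balls of radius 1) centred at the vertices of $C$ partition $V$. Since $p^l \mid n$, congruence modulo $p^l$ of elements of $\mathbb{Z}_n$ is well defined. -}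

module Defs where

open import Data.Nat using (ℕ; zero; suc; _+_; _∸_; NonZero)
open import Data.Nat.DivMod using (_mod_)
open import Data.Fin using (Fin; toℕ)
open import Data.Fin.Subset using (Subset; _∈_)
open import Data.Product using (Σ; _×_; _,_)
open import Data.Sum using (_⊎_)
open import Data.Integer using (ℤ; +_; _-_)
open import Data.Integer.Divisibility using (_∣_)
open import Relation.Binary.PropositionalEquality using (_≡_)

module _ (n : ℕ) .{{_ : NonZero n}} where

  0ₙ : Fin n
  0ₙ = 0 mod n

  _+ₙ_ : Fin n → Fin n → Fin n
  a +ₙ b = (toℕ a + toℕ b) mod n

  -ₙ_ : Fin n → Fin n
  -ₙ a = (n ∸ toℕ a) mod n

  _-ₙ_ : Fin n → Fin n → Fin n
  a -ₙ b = a +ₙ (-ₙ b)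

  Adj : Subset n → Fin n → Fin n → Set
  Adj S u v = (v -ₙ u) ∈ S

  data Reachable (S : Subset n) : Fin n → Fin n → Set where
    here : ∀ {u} → Reachable S u u
    step : ∀ {u v w} → Adj S u v → Reachable S v w → Reachable S u w

  Connected : Subset n → Set
  Connected S = ∀ u v → Reachable S u v

  InBall : Subset n → Fin n → Fin n → Set
  InBall S c v = v ≡ c ⊎ Adj S c v

  IsPerfectCode : Subset n → Subset n → Set
  IsPerfectCode S C =
    ∀ v → Σ (Fin n) λ c → (c ∈ C × InBall S c v)
                         × (∀ c' → c' ∈ C → InBall S c' v → c' ≡ c)

  HasPerfectCode : Subset n → Set
  HasPerfectCode S = Σ (Subset n) λ C → IsPerfectCode S C

_≡_[mod_] : ℕ → ℕ → ℕ → Set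
a ≡ b [mod m ] = (+ m) ∣ ((+ a) - (+ b))

-- Write n = m·K with K = pˡ, p ∤ m, and A = S ∪ {0}, so |A| = K.  The closed ball around c is
-- c + A, so a perfect code is exactly a tiling complement C of A: A ⊕ C = ℤ_n.  Let classSize r = #{a ∈ A | a ≡ −r (mod K)}; these
-- K numbers add up to K, so A is a transversal mod K iff no class is empty iff none holds two.
--  (⇐) If A is a transversal mod K, the multiples of K form a tiling complement.
--  (⇒) Count Q r = #{(a, c₁, …, c_K) ∈ A × C^K | r + a + Σ cᵢ ≡ 0 (mod K)} twice.  Via the tiling,
--      Q r = m · |C|^(K−1) = m^K.  Modulo p, since p ∣ C(K, j) for 0 < j < K, the K-th power of
--      Σ_{c ∈ C} x^c in the group ring of ℤ_K is |C| = m (Frobenius), so Q r ≡ m · classSize r.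
--      As p ∤ m, no class is empty.

module Submission where

open import Data.Bool.Base using (true; false; if_then_else_)
open import Data.Empty using (⊥; ⊥-elim)
open import Data.Fin.Base using (Fin; toℕ) renaming (zero to fzero; suc to fsuc)
open import Data.Fin.Permutation using (Permutation′; permutation)
open import Data.Fin.Properties
  using (toℕ<n; toℕ-inject₁; toℕ-fromℕ; toℕ-fromℕ<; toℕ-injective)
  renaming (suc-injective to fsuc-injective; _≟_ to _≟ᶠ_)
open import Data.Fin.Subset using (Subset; _∈_; _∉_; _∪_; ⁅_⁆; ∣_∣)
open import Data.Fin.Subset.Properties using (_∈?_; ∪-identityʳ; x∈p∪q⁻; x∈p∪q⁺; x∈⁅y⁆⇒x≡y; x∈⁅x⁆)
import Data.Integer.Base as ℤ
open import Data.Integer.Properties using (m-n≡m⊖n; ∣⊖∣-≤; ∣m⊖n∣≡∣n⊖m∣)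
open import Data.List.Base using (List; []; _∷_; length)
open import Data.Nat.Base
open import Data.Nat.Combinatorics
  using (nCk+nC[k+1]≡[n+1]C[k+1]; k>n⇒nCk≡0; nCn≡1; nC1≡n) renaming (_C_ to _choose_)
open import Data.Nat.DivMod
open import Data.Nat.Divisibility
  using (_∣_; _∣?_; _∣0; 1∣_; divides; m%n≡0⇒n∣m; ∣m∣n⇒∣m+n; ∣-trans; m∣m*n; *-monoʳ-∣; *-cancelˡ-∣; ∣⇒≤)
open import Data.Nat.Primality using (Prime; euclidsLemma; prime⇒nonZero)
open import Data.Nat.Properties
open import Algebra.Properties.CommutativeSemigroup +-commutativeSemigroup
  using (x∙yz≈y∙xz; x∙yz≈xz∙y; xy∙z≈xz∙y)
open import Algebra.Properties.CommutativeSemigroup *-commutativeSemigroup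
  using () renaming (x∙yz≈y∙xz to m*[n*o]≡n*[m*o])
open import Algebra.Properties.Semiring.Sum +-*-semiring
  using (sum; sum-cong-≗; sum-replicate-zero; sum-init-last; ∑-comm; ∑-distrib-+; ∑-permute;
         *-distribˡ-sum; *-distribʳ-sum)
open import Data.Product using (Σ; ∃-syntax; _×_; _,_; map)
open import Data.Sum using (inj₁; inj₂)
open import Data.Vec.Base using ([]; _∷_; here; there; tabulate)
open import Data.Vec.Properties using (lookup∘tabulate; []=⇒lookup; lookup⇒[]=)
open import Function.Base using (_∘_; id)
open import Function.Bundles using (_⇔_; mk⇔; Equivalence)
open import Relation.Binary.PropositionalEquality
open import Relation.Nullary using (Dec; yes; no; does; ¬_)
open import Relation.Nullary.Decidable using (dec-true)

open import Defs using (0ₙ; _+ₙ_; -ₙ_; _-ₙ_; InBall; IsPerfectCode; HasPerfectCode; Connected; _≡_[mod_])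

open ≡-Reasoning


sum-const : ∀ {N} c → sum {N} (λ _ → c) ≡ N * c
sum-const {zero}  c = refl
sum-const {suc N} c = cong (c +_) (sum-const {N} c)

sum-vanishing : ∀ {N} {f : Fin N → ℕ} → (∀ i → f i ≡ 0) → sum f ≡ 0
sum-vanishing {N} f≡0 = trans (sum-cong-≗ f≡0) (sum-replicate-zero N)

sum-mono-≤ : ∀ {N} {f g : Fin N → ℕ} → (∀ i → f i ≤ g i) → sum f ≤ sum g
sum-mono-≤ {zero}  _   = z≤n
sum-mono-≤ {suc N} f≤g = +-mono-≤ (f≤g fzero) (sum-mono-≤ (f≤g ∘ fsuc))

sum-mono-< : ∀ {N} {f g : Fin N → ℕ} → (∀ i → f i ≤ g i) → ∀ i → f i < g i → sum f < sum g
sum-mono-< f≤g fzero    f<g = +-mono-<-≤ f<g (sum-mono-≤ (f≤g ∘ fsuc))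
sum-mono-< f≤g (fsuc i) f<g = +-mono-≤-< (f≤g fzero) (sum-mono-< (f≤g ∘ fsuc) i f<g)

pair≤sum : ∀ {N} (f : Fin N → ℕ) {i j} → i ≢ j → f i + f j ≤ sum f
pair≤sum f {fzero}  {fzero}  i≢j = ⊥-elim (i≢j refl)
pair≤sum f {fzero}  {fsuc j} _   = +-monoʳ-≤ (f fzero) (term≤sum (f ∘ fsuc) j)
  where
  term≤sum : ∀ {N} (g : Fin N → ℕ) i → g i ≤ sum g
  term≤sum g fzero    = m≤m+n _ _
  term≤sum g (fsuc i) = ≤-trans (term≤sum (g ∘ fsuc) i) (m≤n+m _ (g fzero))
pair≤sum f {fsuc i} {fzero}  i≢j = subst (_≤ sum f) (+-comm (f fzero) _) (pair≤sum f (i≢j ∘ sym))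
pair≤sum f {fsuc i} {fsuc j} i≢j =
  ≤-trans (pair≤sum (f ∘ fsuc) (i≢j ∘ cong fsuc)) (m≤n+m _ (f fzero))

sum-concentrated : ∀ {N} (f : Fin N → ℕ) c → (∀ i → i ≢ c → f i ≡ 0) → sum f ≡ f c
sum-concentrated f fzero    off =
  trans (cong (f fzero +_) (sum-vanishing (λ i → off (fsuc i) λ ()))) (+-identityʳ _)
sum-concentrated f (fsuc c) off =
  trans (cong (_+ sum (f ∘ fsuc)) (off fzero λ ()))
        (sum-concentrated (f ∘ fsuc) c (λ i i≢c → off (fsuc i) (i≢c ∘ fsuc-injective)))

sum-positive : ∀ {N} (f : Fin N → ℕ) → 0 < sum f → ∃[ i ] 0 < f i
sum-positive {suc N} f pos with 0 <? f fzero
... | yes f₀>0 = fzero , f₀>0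
... | no  f₀≯0 = map fsuc id (sum-positive (f ∘ fsuc) (subst (λ x → 0 < x + sum (f ∘ fsuc)) f₀≡0 pos))
  where
  f₀≡0 : f fzero ≡ 0
  f₀≡0 = n≤0⇒n≡0 (≮⇒≥ f₀≯0)

∣-sum : ∀ {N d} (f : Fin N → ℕ) → (∀ i → d ∣ f i) → d ∣ sum f
∣-sum {zero}  f _   = divides 0 refl
∣-sum {suc N} f d∣f = ∣m∣n⇒∣m+n (d∣f fzero) (∣-sum (f ∘ fsuc) (d∣f ∘ fsuc))

sum-%-cong : ∀ {N} d .{{_ : NonZero d}} (f g : Fin N → ℕ) →
             (∀ i → f i % d ≡ g i % d) → sum f % d ≡ sum g % d
sum-%-cong {zero}  d f g _   = refl
sum-%-cong {suc N} d f g f≋g = begin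
  (f fzero + sum (f ∘ fsuc)) % d
    ≡⟨ %-distribˡ-+ (f fzero) _ d ⟩
  (f fzero % d + sum (f ∘ fsuc) % d) % d
    ≡⟨ cong₂ (λ x y → (x + y) % d) (f≋g fzero) (sum-%-cong d _ _ (f≋g ∘ fsuc)) ⟩
  (g fzero % d + sum (g ∘ fsuc) % d) % d
    ≡⟨ %-distribˡ-+ (g fzero) _ d ⟨
  (g fzero + sum (g ∘ fsuc)) % d ∎

sum≡N∧≥1⇒≤1 : ∀ {N} (f : Fin N → ℕ) → sum f ≡ N → (∀ i → 1 ≤ f i) → ∀ i → f i ≤ 1
sum≡N∧≥1⇒≤1 {N} f ∑f≡N 1≤f i = ≮⇒≥ λ 1<fᵢ →
  <-irrefl refl (subst₂ _<_ (trans (sum-const {N} 1) (*-identityʳ N)) ∑f≡N (sum-mono-< 1≤f i 1<fᵢ))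

sum≡N∧≤1⇒≥1 : ∀ {N} (f : Fin N → ℕ) → sum f ≡ N → (∀ i → f i ≤ 1) → ∀ i → 1 ≤ f i
sum≡N∧≤1⇒≥1 {N} f ∑f≡N f≤1 i = ≮⇒≥ λ fᵢ<1 →
  <-irrefl refl (subst₂ _<_ ∑f≡N (trans (sum-const {N} 1) (*-identityʳ N)) (sum-mono-< f≤1 i fᵢ<1))

-- ∑< N f = f 0 + ⋯ + f (N ∸ 1), realised as a sum over Fin N so that the laws above apply.
-- Range sums carry the binomial expansions and the sums over residues modulo K.
∑< : ℕ → (ℕ → ℕ) → ℕ
∑< N f = sum {N} (f ∘ toℕ)

∑<-cong : ∀ N {f g} → (∀ i → i < N → f i ≡ g i) → ∑< N f ≡ ∑< N g
∑<-cong N f≡g = sum-cong-≗ (λ i → f≡g (toℕ i) (toℕ<n i))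

∑<-last : ∀ N f → ∑< (suc N) f ≡ ∑< N f + f N
∑<-last N f = trans (sum-init-last {N} (f ∘ toℕ))
  (cong₂ _+_ (sum-cong-≗ {N} (cong f ∘ toℕ-inject₁)) (cong f (toℕ-fromℕ N)))

∑<-split : ∀ a b f → ∑< (a + b) f ≡ ∑< a f + ∑< b (λ i → f (a + i))
∑<-split zero    b f = refl
∑<-split (suc a) b f = trans (cong (f 0 +_) (∑<-split a b (f ∘ suc))) (sym (+-assoc (f 0) _ _))

-- sumL L f = Σ_{c ∈ L} f c, a sum over a list of numbers (with multiplicity); the list will hold
-- the members of a perfect code, as steps of walks in ℤ_K.
sumL : List ℕ → (ℕ → ℕ) → ℕ
sumL []      f = 0
sumL (c ∷ L) f = f c + sumL L f

sumL-cong : ∀ L {f g} → (∀ c → f c ≡ g c) → sumL L f ≡ sumL L g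
sumL-cong []      f≡g = refl
sumL-cong (c ∷ L) f≡g = cong₂ _+_ (f≡g c) (sumL-cong L f≡g)

sumL-const : ∀ L a → sumL L (λ _ → a) ≡ length L * a
sumL-const []      a = refl
sumL-const (c ∷ L) a = cong (a +_) (sumL-const L a)

sumL-* : ∀ L a f → sumL L (λ c → a * f c) ≡ a * sumL L f
sumL-* []      a f = sym (*-zeroʳ a)
sumL-* (c ∷ L) a f = trans (cong (a * f c +_) (sumL-* L a f)) (sym (*-distribˡ-+ a (f c) _))

sumL-∑< : ∀ L N (F : ℕ → ℕ → ℕ) → sumL L (λ c → ∑< N (F c)) ≡ ∑< N (λ j → sumL L (λ c → F c j))
sumL-∑< []      N F = sym (sum-vanishing {N} (λ _ → refl))
sumL-∑< (c ∷ L) N F =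
  trans (cong (∑< N (F c) +_) (sumL-∑< L N F)) (sym (∑-distrib-+ {N} (F c ∘ toℕ) _))

𝟙 : ∀ {a} {P : Set a} → Dec P → ℕ
𝟙 d = if does d then 1 else 0

𝟙-yes : ∀ {a} {P : Set a} (d : Dec P) → P → 𝟙 d ≡ 1
𝟙-yes (yes _) _ = refl
𝟙-yes (no ¬p) p = ⊥-elim (¬p p)

𝟙-no : ∀ {a} {P : Set a} (d : Dec P) → ¬ P → 𝟙 d ≡ 0
𝟙-no (yes p) ¬p = ⊥-elim (¬p p)
𝟙-no (no _)  _  = refl

𝟙≤1 : ∀ {a} {P : Set a} (d : Dec P) → 𝟙 d ≤ 1
𝟙≤1 (yes _) = ≤-refl
𝟙≤1 (no _)  = z≤n

𝟙*𝟙-pos : ∀ {a b} {P : Set a} {Q : Set b} (d : Dec P) (e : Dec Q) → 0 < 𝟙 d * 𝟙 e → P × Q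
𝟙*𝟙-pos (yes p) (yes q) _ = p , q
𝟙*𝟙-pos (yes _) (no _)  ()
𝟙*𝟙-pos (no _)  _       ()

𝟙*𝟙≡1 : ∀ {a b} {P : Set a} {Q : Set b} (d : Dec P) (e : Dec Q) → P → Q → 𝟙 d * 𝟙 e ≡ 1
𝟙*𝟙≡1 d e p q = cong₂ _*_ (𝟙-yes d p) (𝟙-yes e q)

𝟙*𝟙≡0 : ∀ {a b} {P : Set a} {Q : Set b} (d : Dec P) (e : Dec Q) →
         (P → Q → ⊥) → 𝟙 d * 𝟙 e ≡ 0
𝟙*𝟙≡0 (yes p) (yes q) ¬pq = ⊥-elim (¬pq p q)
𝟙*𝟙≡0 (yes _) (no _)  _   = refl
𝟙*𝟙≡0 (no _)  _       _   = refl

𝟙*𝟙≤1 : ∀ {a b} {P : Set a} {Q : Set b} (d : Dec P) (e : Dec Q) → 𝟙 d * 𝟙 e ≤ 1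
𝟙*𝟙≤1 d e = *-mono-≤ (𝟙≤1 d) (𝟙≤1 e)

does≡true⇒ : ∀ {a} {P : Set a} (d : Dec P) → does d ≡ true → P
does≡true⇒ (yes p) _ = p

∑𝟙≡∣∣ : ∀ {N} (p : Subset N) → sum (λ i → 𝟙 (i ∈? p)) ≡ ∣ p ∣
∑𝟙≡∣∣ []          = refl
∑𝟙≡∣∣ (true ∷ p)  = cong suc (∑𝟙≡∣∣ p)
∑𝟙≡∣∣ (false ∷ p) = ∑𝟙≡∣∣ p

∣p∪⁅x⁆∣ : ∀ {N} (p : Subset N) x → x ∉ p → ∣ p ∪ ⁅ x ⁆ ∣ ≡ suc ∣ p ∣
∣p∪⁅x⁆∣ (true ∷ p)  fzero    x∉p = ⊥-elim (x∉p here)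
∣p∪⁅x⁆∣ (false ∷ p) fzero    _   = cong (suc ∘ ∣_∣) (∪-identityʳ p)
∣p∪⁅x⁆∣ (true ∷ p)  (fsuc x) x∉p = cong suc (∣p∪⁅x⁆∣ p x (x∉p ∘ there))
∣p∪⁅x⁆∣ (false ∷ p) (fsuc x) x∉p = ∣p∪⁅x⁆∣ p x (x∉p ∘ there)

memberValues : ∀ {N} → Subset N → (Fin N → ℕ) → List ℕ
memberValues []          e = []
memberValues (true ∷ p)  e = e fzero ∷ memberValues p (e ∘ fsuc)
memberValues (false ∷ p) e = memberValues p (e ∘ fsuc)

length-memberValues : ∀ {N} (p : Subset N) e → length (memberValues p e) ≡ ∣ p ∣
length-memberValues []          e = refl
length-memberValues (true ∷ p)  e = cong suc (length-memberValues p (e ∘ fsuc))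
length-memberValues (false ∷ p) e = length-memberValues p (e ∘ fsuc)

sumL-memberValues : ∀ {N} (p : Subset N) e f →
                    sumL (memberValues p e) f ≡ sum (λ i → 𝟙 (i ∈? p) * f (e i))
sumL-memberValues []          e f = refl
sumL-memberValues (true ∷ p)  e f =
  cong₂ _+_ (sym (+-identityʳ (f (e fzero)))) (sumL-memberValues p (e ∘ fsuc) f)
sumL-memberValues (false ∷ p) e f = sumL-memberValues p (e ∘ fsuc) f

%-cong-+ʳ : ∀ a b c d .{{_ : NonZero d}} → a % d ≡ b % d → (a + c) % d ≡ (b + c) % d
%-cong-+ʳ a b c d a≡b = begin
  (a + c) % d               ≡⟨ %-distribˡ-+ a c d ⟩
  (a % d + c % d) % d       ≡⟨ cong (λ r → (r + c % d) % d) a≡b ⟩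
  (b % d + c % d) % d       ≡⟨ %-distribˡ-+ b c d ⟨
  (b + c) % d               ∎

[m%d+n]%d≡[m+n]%d : ∀ m n d .{{_ : NonZero d}} → (m % d + n) % d ≡ (m + n) % d
[m%d+n]%d≡[m+n]%d m n d = %-cong-+ʳ (m % d) m n d (m%n%n≡m%n m d)

[m+n%d]%d≡[m+n]%d : ∀ m n d .{{_ : NonZero d}} → (m + n % d) % d ≡ (m + n) % d
[m+n%d]%d≡[m+n]%d m n d = begin
  (m + n % d) % d   ≡⟨ cong (_% d) (+-comm m (n % d)) ⟩
  (n % d + m) % d   ≡⟨ [m%d+n]%d≡[m+n]%d n m d ⟩
  (n + m) % d       ≡⟨ cong (_% d) (+-comm n m) ⟩
  (m + n) % d       ∎

toℕ-mod : ∀ x d .{{_ : NonZero d}} → toℕ (x mod d) ≡ x % d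
toℕ-mod x d = toℕ-fromℕ< (m%n<n x d)

C-absorption : ∀ n k → suc k * (suc n choose suc k) ≡ suc n * (n choose k)
C-absorption zero    zero    = refl
C-absorption zero    (suc k) = *-zeroʳ (suc (suc k))
C-absorption (suc n) zero    =
  trans (+-identityʳ _) (trans (nC1≡n (suc (suc n))) (sym (*-identityʳ (suc (suc n)))))
C-absorption (suc n) (suc k) = begin
  suc (suc k) * (suc (suc n) choose suc (suc k))
    ≡⟨ cong (suc (suc k) *_) (nCk+nC[k+1]≡[n+1]C[k+1] (suc n) (suc k)) ⟨
  suc (suc k) * (X + Y)
    ≡⟨ *-distribˡ-+ (suc (suc k)) X Y ⟩
  (X + suc k * X) + suc (suc k) * Y
    ≡⟨ cong₂ (λ u v → (X + u) + v) (C-absorption n k) (C-absorption n (suc k)) ⟩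
  (X + suc n * (n choose k)) + suc n * (n choose suc k)
    ≡⟨ +-assoc X _ _ ⟩
  X + (suc n * (n choose k) + suc n * (n choose suc k))
    ≡⟨ cong (X +_) (*-distribˡ-+ (suc n) (n choose k) (n choose suc k)) ⟨
  X + suc n * (n choose k + n choose suc k)
    ≡⟨ cong (λ z → X + suc n * z) (nCk+nC[k+1]≡[n+1]C[k+1] n k) ⟩
  X + suc n * X ∎
  where
  X Y : ℕ
  X = suc n choose suc k
  Y = suc n choose suc (suc k)

n∣[k+1]*nC[k+1] : ∀ n k → n ∣ suc k * (n choose suc k)
n∣[k+1]*nC[k+1] zero    k = subst (0 ∣_) (sym (*-zeroʳ (suc k))) (0 ∣0)
n∣[k+1]*nC[k+1] (suc n) k = divides (n choose k) (trans (C-absorption n k) (*-comm (suc n) _))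

p∤cofactor : ∀ {p n m} l → n ≡ m * p ^ l → ¬ p ^ (l + 1) ∣ n → ¬ p ∣ m
p∤cofactor {p} {n} l n≡m*pˡ pˡ⁺¹∤n (divides t refl) = pˡ⁺¹∤n (divides t (begin
  n                 ≡⟨ n≡m*pˡ ⟩
  t * p * p ^ l     ≡⟨ *-assoc t p (p ^ l) ⟩
  t * p ^ (1 + l)   ≡⟨ cong (λ e → t * p ^ e) (+-comm 1 l) ⟩
  t * p ^ (l + 1)   ∎))

module _ {p : ℕ} (p-prime : Prime p) where

  pˡ∣j*X⇒pˡ∣j : ∀ {X} → ¬ p ∣ X → ∀ l j → p ^ l ∣ j * X → p ^ l ∣ j
  pˡ∣j*X⇒pˡ∣j p∤X zero    j _ = 1∣ j
  pˡ∣j*X⇒pˡ∣j {X} p∤X (suc l) j pˡ⁺¹∣jX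
    with euclidsLemma j X p-prime (∣-trans (m∣m*n (p ^ l)) pˡ⁺¹∣jX)
  ... | inj₂ p∣X = ⊥-elim (p∤X p∣X)
  ... | inj₁ (divides q refl) = subst (p * p ^ l ∣_) (*-comm p q) (*-monoʳ-∣ p pˡ∣q)
    where
    instance
      p≢0 : NonZero p
      p≢0 = prime⇒nonZero p-prime
    pˡ∣q : p ^ l ∣ q
    pˡ∣q = pˡ∣j*X⇒pˡ∣j p∤X l q (*-cancelˡ-∣ p
      (subst (p * p ^ l ∣_) (trans (cong (_* X) (*-comm q p)) (*-assoc p q X)) pˡ⁺¹∣jX))

  p∣pˡCj : ∀ l j → 0 < j → j < p ^ l → p ∣ p ^ l choose j
  p∣pˡCj l (suc j) _ j<pˡ with p ∣? p ^ l choose suc j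
  ... | yes p∣C = p∣C
  ... | no  p∤C = ⊥-elim (<⇒≱ j<pˡ (∣⇒≤ pˡ∣j))
    where
    -- j · C(pˡ, j) = pˡ · C(pˡ − 1, j − 1), so pˡ ∣ j, impossible for 0 < j < pˡ.
    pˡ∣j : p ^ l ∣ suc j
    pˡ∣j = pˡ∣j*X⇒pˡ∣j p∤C l (suc j) (n∣[k+1]*nC[k+1] (p ^ l) j)

  p∣mᵏ⁺¹⇒p∣m : ∀ {m} k → p ∣ m ^ suc k → p ∣ m
  p∣mᵏ⁺¹⇒p∣m {m} zero    p∣m¹ = subst (p ∣_) (*-identityʳ m) p∣m¹
  p∣mᵏ⁺¹⇒p∣m {m} (suc k) p∣mᵏ⁺² with euclidsLemma m (m ^ suc k) p-prime p∣mᵏ⁺²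
  ... | inj₁ p∣m   = p∣m
  ... | inj₂ p∣mᵏ⁺¹ = p∣mᵏ⁺¹⇒p∣m k p∣mᵏ⁺¹

pascal-sum : ∀ k (x : ℕ → ℕ) →
  ∑< (suc k) (λ j → (k choose j) * x (suc j)) + ∑< (suc k) (λ j → (k choose j) * x j)
    ≡ ∑< (suc (suc k)) (λ j → (suc k choose j) * x j)
pascal-sum k x = begin
  A + (x₀ + B)
    ≡⟨ x∙yz≈y∙xz A x₀ B ⟩
  x₀ + (A + B)
    ≡⟨ cong (λ z → x₀ + (A + z)) B≡B′ ⟩
  x₀ + (A + B′)
    ≡⟨ cong (x₀ +_) (∑-distrib-+ {suc k} (a ∘ toℕ) (b ∘ toℕ)) ⟨
  x₀ + ∑< (suc k) (λ j → a j + b j)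
    ≡⟨ cong (x₀ +_) (sum-cong-≗ {suc k} (pascal ∘ toℕ)) ⟩
  x₀ + ∑< (suc k) (λ j → (suc k choose suc j) * x (suc j)) ∎
  where
  a b : ℕ → ℕ
  a j = (k choose j) * x (suc j)
  b j = (k choose suc j) * x (suc j)
  x₀ A B B′ : ℕ
  x₀ = (k choose 0) * x 0
  A  = ∑< (suc k) a
  B  = ∑< k b
  B′ = ∑< (suc k) b
  -- The extra last term of B′ vanishes, since C(k, k+1) = 0.
  B≡B′ : B ≡ B′
  B≡B′ = sym (trans (∑<-last k b)
    (trans (cong (λ z → B + z * x (suc k)) (k>n⇒nCk≡0 (n<1+n k))) (+-identityʳ B)))
  pascal : ∀ j → a j + b j ≡ (suc k choose suc j) * x (suc j)
  pascal j = trans (sym (*-distribʳ-+ (x (suc j)) (k choose j) (k choose suc j)))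
                   (cong (_* x (suc j)) (nCk+nC[k+1]≡[n+1]C[k+1] k j))

module Residues (K-1 : ℕ) where

  K : ℕ
  K = suc K-1

  infix 4 _≋_
  _≋_ : ℕ → ℕ → Set
  x ≋ y = x % K ≡ y % K

  ≋-+ʳ : ∀ x y z → x ≋ y → x + z ≋ y + z
  ≋-+ʳ x y z x≋y = %-cong-+ʳ x y z K x≋y

  ≋-+ˡ : ∀ z x y → x ≋ y → z + x ≋ z + y
  ≋-+ˡ z x y x≋y =
    trans (cong (_% K) (+-comm z x)) (trans (≋-+ʳ x y z x≋y) (cong (_% K) (+-comm y z)))

  ≋0-+ : ∀ w y → w ≋ 0 → w + y ≋ y
  ≋0-+ w y w≋0 = %-cong-+ʳ w 0 y K w≋0

  [K∸x%K]+x≋0 : ∀ x → (K ∸ x % K) + x ≋ 0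
  [K∸x%K]+x≋0 x = begin
    ((K ∸ x % K) + x) % K        ≡⟨ ≋-+ˡ (K ∸ x % K) x (x % K) (sym (m%n%n≡m%n x K)) ⟩
    ((K ∸ x % K) + x % K) % K    ≡⟨ cong (_% K) (m∸n+n≡m (m%n≤n x K)) ⟩
    K % K                        ≡⟨ n%n≡0 K ⟩
    0                            ∎

  ≋-cancelˡ : ∀ z x y → z + x ≋ z + y → x ≋ y
  ≋-cancelˡ z x y z+x≋z+y = begin
    x % K              ≡⟨ ≋0-+ (w + z) x ([K∸x%K]+x≋0 z) ⟨
    (w + z + x) % K    ≡⟨ cong (_% K) (+-assoc w z x) ⟩
    (w + (z + x)) % K  ≡⟨ ≋-+ˡ w (z + x) (z + y) z+x≋z+y ⟩
    (w + (z + y)) % K  ≡⟨ cong (_% K) (+-assoc w z y) ⟨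
    (w + z + y) % K    ≡⟨ ≋0-+ (w + z) y ([K∸x%K]+x≋0 z) ⟩
    y % K              ∎
    where
    w : ℕ
    w = K ∸ z % K

  -[_] : ℕ → Fin K
  -[ x ] = (K ∸ x % K) mod K

  -[x]+x≋0 : ∀ x → toℕ -[ x ] + x ≋ 0
  -[x]+x≋0 x = trans (cong (λ z → (z + x) % K) (toℕ-mod (K ∸ x % K) K))
                     (trans ([m%d+n]%d≡[m+n]%d (K ∸ x % K) x K) ([K∸x%K]+x≋0 x))

  -[x]+y≋0⇒y≋x : ∀ x y → toℕ -[ x ] + y ≋ 0 → y ≋ x
  -[x]+y≋0⇒y≋x x y r+y≋0 = ≋-cancelˡ (toℕ -[ x ]) y x (trans r+y≋0 (sym (-[x]+x≋0 x)))

  y≋x⇒-[x]+y≋0 : ∀ x y → y ≋ x → toℕ -[ x ] + y ≋ 0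
  y≋x⇒-[x]+y≋0 x y y≋x = trans (≋-+ˡ (toℕ -[ x ]) y x y≋x) (-[x]+x≋0 x)

  -- Functions on ℕ that only depend on the residue modulo K, i.e. functions on ℤ_K.
  Periodic : (ℕ → ℕ) → Set
  Periodic h = ∀ x y → x ≋ y → h x ≡ h y

  δ : ℕ → ℕ
  δ x = 𝟙 (x % K ≟ 0)

  δ-periodic : Periodic δ
  δ-periodic _ _ x≋y = cong (λ r → 𝟙 (r ≟ 0)) x≋y

  ∑<-window : ∀ h → Periodic h → ∀ x → ∑< K (λ s → h (x + s)) ≡ ∑< K h
  ∑<-window h h-per zero    = refl
  ∑<-window h h-per (suc x) = begin
    ∑< K (λ s → h (suc x + s))  ≡⟨ ∑<-cong K (λ s _ → cong h (sym (+-suc x s))) ⟩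
    ∑< K (f ∘ suc)              ≡⟨ +-cancelʳ-≡ (f 0) _ _ rotate ⟩
    ∑< K f                      ≡⟨ ∑<-window h h-per x ⟩
    ∑< K h                      ∎
    where
    f : ℕ → ℕ
    f s = h (x + s)
    x+K≋x+0 : x + K ≋ x + 0
    x+K≋x+0 = trans ([m+n]%n≡m%n x K) (cong (_% K) (sym (+-identityʳ x)))
    rotate : ∑< K (f ∘ suc) + f 0 ≡ ∑< K f + f 0
    rotate = begin
      ∑< K (f ∘ suc) + f 0
        ≡⟨ +-comm _ (f 0) ⟩
      ∑< (suc K) f
        ≡⟨ ∑<-last K f ⟩
      ∑< K f + f K
        ≡⟨ cong (∑< K f +_) (h-per (x + K) (x + 0) x+K≋x+0) ⟩
      ∑< K f + f 0 ∎

  ∑<-periods : ∀ h → Periodic h → ∀ m → ∑< (m * K) h ≡ m * ∑< K h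
  ∑<-periods h h-per zero    = refl
  ∑<-periods h h-per (suc m) = begin
    ∑< (K + m * K) h
      ≡⟨ ∑<-split K (m * K) h ⟩
    ∑< K h + ∑< (m * K) (λ s → h (K + s))
      ≡⟨ cong (∑< K h +_) (∑<-cong (m * K) (λ s _ → h-per (K + s) s (K+s≋s s))) ⟩
    ∑< K h + ∑< (m * K) h
      ≡⟨ cong (∑< K h +_) (∑<-periods h h-per m) ⟩
    ∑< K h + m * ∑< K h ∎
    where
    K+s≋s : ∀ s → K + s ≋ s
    K+s≋s s = trans (cong (_% K) (+-comm K s)) ([m+n]%n≡m%n s K)

  δ-window : ∀ x → ∑< K (λ s → δ (x + s)) ≡ 1
  δ-window x = trans (∑<-window δ δ-periodic x)
                     (cong suc (sum-vanishing (λ i → 𝟙-no (suc (toℕ i) % K ≟ 0) (1+i%K≢0 i))))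
    where
    1+i%K≢0 : ∀ (i : Fin K-1) → suc (toℕ i) % K ≢ 0
    1+i%K≢0 i = 1+n≢0 ∘ trans (sym (m<n⇒m%n≡m (s<s (toℕ<n i))))

module Walks (K-1 : ℕ) where

  open Residues K-1

  -- walks L k g counts the k-tuples (c₁, …, c_k) over L with g + c₁ + ⋯ + c_k ≡ 0 (mod K);
  -- it is the coefficient of x^(−g) in (Σ_{c ∈ L} x^c)^k in the group ring of ℤ_K.
  walks : List ℕ → ℕ → ℕ → ℕ
  walks L zero    g = δ g
  walks L (suc k) g = sumL L (λ c → walks L k (g + c))

  walks-periodic : ∀ L k → Periodic (walks L k)
  walks-periodic L zero    = δ-periodic
  walks-periodic L (suc k) x y x≋y =
    sumL-cong L (λ c → walks-periodic L k (x + c) (y + c) (≋-+ʳ x y c x≋y))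

  -- Summed over all residues g, every k-tuple is counted once.
  walks-total : ∀ L k x → ∑< K (λ s → walks L k (x + s)) ≡ length L ^ k
  walks-total L zero    x = δ-window x
  walks-total L (suc k) x = begin
    ∑< K (λ s → sumL L (λ c → walks L k ((x + s) + c)))
      ≡⟨ sumL-∑< L K (λ c s → walks L k ((x + s) + c)) ⟨
    sumL L (λ c → ∑< K (λ s → walks L k ((x + s) + c)))
      ≡⟨ sumL-cong L (λ c → ∑<-cong K (λ s _ → cong (walks L k) (xy∙z≈xz∙y x s c))) ⟩
    sumL L (λ c → ∑< K (λ s → walks L k ((x + c) + s)))
      ≡⟨ sumL-cong L (λ c → walks-total L k (x + c)) ⟩
    sumL L (λ _ → length L ^ k)
      ≡⟨ sumL-const L _ ⟩
    length L * length L ^ k ∎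

  -- Binomial theorem: sorting the tuples over c ∷ L by the number j of entries taken from the head c
  -- gives  walks (c ∷ L) k g = Σ_{j ≤ k} C(k, j) · walks L (k − j) (g + j·c).
  walks-binomial : ∀ c L k g →
    walks (c ∷ L) k g ≡ ∑< (suc k) (λ j → (k choose j) * walks L (k ∸ j) (g + j * c))
  walks-binomial c L zero    g = sym (trans (+-identityʳ _) (trans (+-identityʳ _) (cong δ (+-identityʳ g))))
  walks-binomial c L (suc k) g = begin
    walks (c ∷ L) k (g + c) + sumL L (λ c′ → walks (c ∷ L) k (g + c′))
      ≡⟨ cong₂ _+_ (walks-binomial c L k (g + c)) (sumL-cong L (λ c′ → walks-binomial c L k (g + c′))) ⟩
    ∑< (suc k) (λ j → (k choose j) * W j (g + c)) + sumL L (λ c′ → ∑< (suc k) (λ j → (k choose j) * W j (g + c′)))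
      ≡⟨ cong₂ _+_ first-step-c first-step-in-L ⟩
    ∑< (suc k) (λ j → (k choose j) * X (suc j)) + ∑< (suc k) (λ j → (k choose j) * X j)
      ≡⟨ pascal-sum k X ⟩
    ∑< (suc (suc k)) (λ j → (suc k choose j) * X j) ∎
    where
    -- The k − j remaining steps, from h, once j steps have been taken with c.
    W : ℕ → ℕ → ℕ
    W j h = walks L (k ∸ j) (h + j * c)
    X : ℕ → ℕ
    X j = walks L (suc k ∸ j) (g + j * c)
    -- A first step with c adds one to the number of steps taken with c.
    first-step-c : ∑< (suc k) (λ j → (k choose j) * W j (g + c)) ≡ ∑< (suc k) (λ j → (k choose j) * X (suc j))
    first-step-c = ∑<-cong (suc k) (λ j _ → cong (λ z → (k choose j) * walks L (k ∸ j) z) (+-assoc g c (j * c)))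
    -- A first step in L adds one to the number of steps taken in L.
    first-step-in-L : sumL L (λ c′ → ∑< (suc k) (λ j → (k choose j) * W j (g + c′)))
                    ≡ ∑< (suc k) (λ j → (k choose j) * X j)
    first-step-in-L = begin
      sumL L (λ c′ → ∑< (suc k) (λ j → (k choose j) * W j (g + c′)))
        ≡⟨ sumL-∑< L (suc k) (λ c′ j → (k choose j) * W j (g + c′)) ⟩
      ∑< (suc k) (λ j → sumL L (λ c′ → (k choose j) * W j (g + c′)))
        ≡⟨ ∑<-cong (suc k) (λ j j≤k → trans (sumL-* L (k choose j) _) (cong ((k choose j) *_) (step j (s≤s⁻¹ j≤k)))) ⟩
      ∑< (suc k) (λ j → (k choose j) * X j) ∎
      where
      step : ∀ j → j ≤ k → sumL L (λ c′ → W j (g + c′)) ≡ X j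
      step j j≤k = trans (sumL-cong L (λ c′ → cong (walks L (k ∸ j)) (xy∙z≈xz∙y g c′ (j * c))))
                         (cong (λ i → walks L i (g + j * c)) (sym (+-∸-assoc 1 j≤k)))

  -- Frobenius: if p divides the binomial coefficients C(K, j), 0 < j < K, then K-th powers are additive
  -- modulo p, so (Σ_{c ∈ L} x^c)^K ≡ |L| · x⁰ (mod p) in the group ring of ℤ_K.  Induction on L: of the
  -- binomial expansion only the terms j = 0 (the power for L) and j = K (the K-th power of x^c) survive.
  module _ {p : ℕ} .{{_ : NonZero p}} (p∣KCj : ∀ j → 0 < j → j < K → p ∣ K choose j) where

    walks-frobenius : ∀ L g → walks L K g % p ≡ (length L * δ g) % p
    walks-frobenius []      g = refl
    walks-frobenius (c ∷ L) g = begin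
      walks (c ∷ L) K g % p
        ≡⟨ cong (_% p) (walks-binomial c L K g) ⟩
      (E 0 + ∑< K (E ∘ suc)) % p
        ≡⟨ cong (λ z → (E 0 + z) % p) (∑<-last K-1 (E ∘ suc)) ⟩
      (E 0 + (M + E K)) % p
        ≡⟨ cong (_% p) (x∙yz≈xz∙y (E 0) M (E K)) ⟩
      (E 0 + E K + M) % p
        ≡⟨ %-remove-+ʳ (E 0 + E K) p∣M ⟩
      (E 0 + E K) % p
        ≡⟨ cong (_% p) (cong₂ _+_ E₀≡ E_K≡) ⟩
      (walks L K g + δ g) % p
        ≡⟨ %-cong-+ʳ (walks L K g) (length L * δ g) (δ g) p (walks-frobenius L g) ⟩
      (length L * δ g + δ g) % p
        ≡⟨ cong (_% p) (+-comm (length L * δ g) (δ g)) ⟩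
      (δ g + length L * δ g) % p ∎
      where
      E : ℕ → ℕ
      E j = (K choose j) * walks L (K ∸ j) (g + j * c)
      M : ℕ
      M = ∑< K-1 (E ∘ suc)
      p∣M : p ∣ M
      p∣M = ∣-sum (E ∘ suc ∘ toℕ) λ i → ∣-trans (p∣KCj (suc (toℕ i)) z<s (s<s (toℕ<n i))) (m∣m*n _)
      E₀≡ : E 0 ≡ walks L K g
      E₀≡ = trans (+-identityʳ _) (walks-periodic L K (g + 0) g (cong (_% K) (+-identityʳ g)))
      E_K≡ : E K ≡ δ g
      E_K≡ = begin
        (K choose K) * walks L (K ∸ K) (g + K * c)
          ≡⟨ cong₂ (λ a b → a * walks L b (g + K * c)) (nCn≡1 K) (n∸n≡0 K) ⟩
        δ (g + K * c) + 0
          ≡⟨ +-identityʳ _ ⟩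
        δ (g + K * c)
          ≡⟨ δ-periodic (g + K * c) g (trans (cong (λ z → (g + z) % K) (*-comm K c)) ([m+kn]%n≡m%n g c K)) ⟩
        δ g ∎

module CyclicGroup (n : ℕ) .{{_ : NonZero n}} where

  infixl 6 _⊕_ _⊖_

  _⊕_ : Fin n → Fin n → Fin n
  a ⊕ b = _+ₙ_ n a b

  _⊖_ : Fin n → Fin n → Fin n
  a ⊖ b = _-ₙ_ n a b

  𝟘 : Fin n
  𝟘 = 0ₙ n

  toℕ-⊕ : ∀ a b → toℕ (a ⊕ b) ≡ (toℕ a + toℕ b) % n
  toℕ-⊕ a b = toℕ-mod (toℕ a + toℕ b) n

  toℕ-⊖ : ∀ a b → toℕ (a ⊖ b) ≡ (toℕ a + (n ∸ toℕ b)) % n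
  toℕ-⊖ a b = trans (toℕ-mod _ n)
    (trans (cong (λ z → (toℕ a + z) % n) (toℕ-mod (n ∸ toℕ b) n)) ([m+n%d]%d≡[m+n]%d (toℕ a) (n ∸ toℕ b) n))

  toℕ-𝟘 : toℕ 𝟘 ≡ 0
  toℕ-𝟘 = trans (toℕ-mod 0 n) (m<n⇒m%n≡m (>-nonZero⁻¹ n))

  toℕ%n : ∀ a → toℕ a % n ≡ toℕ a
  toℕ%n a = m<n⇒m%n≡m (toℕ<n a)

  a+[n∸a]≡n : ∀ a → toℕ a + (n ∸ toℕ a) ≡ n
  a+[n∸a]≡n a = m+[n∸m]≡n (<⇒≤ (toℕ<n a))

  private
    cancel-n : ∀ a x → x ≡ n → (toℕ a + x) % n ≡ toℕ a
    cancel-n a x refl = trans ([m+n]%n≡m%n (toℕ a) n) (toℕ%n a)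

  ⊖-⊕-cancel : ∀ v c → (v ⊖ c) ⊕ c ≡ v
  ⊖-⊕-cancel v c = toℕ-injective (begin
    toℕ ((v ⊖ c) ⊕ c)
      ≡⟨ toℕ-⊕ (v ⊖ c) c ⟩
    (toℕ (v ⊖ c) + toℕ c) % n
      ≡⟨ cong (λ z → (z + toℕ c) % n) (toℕ-⊖ v c) ⟩
    ((toℕ v + (n ∸ toℕ c)) % n + toℕ c) % n
      ≡⟨ [m%d+n]%d≡[m+n]%d (toℕ v + (n ∸ toℕ c)) (toℕ c) n ⟩
    (toℕ v + (n ∸ toℕ c) + toℕ c) % n
      ≡⟨ cong (_% n) (+-assoc (toℕ v) (n ∸ toℕ c) (toℕ c)) ⟩
    (toℕ v + ((n ∸ toℕ c) + toℕ c)) % n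
      ≡⟨ cancel-n v _ (trans (+-comm (n ∸ toℕ c) (toℕ c)) (a+[n∸a]≡n c)) ⟩
    toℕ v ∎)

  ⊕-⊖-cancel : ∀ a c → (a ⊕ c) ⊖ c ≡ a
  ⊕-⊖-cancel a c = toℕ-injective (begin
    toℕ ((a ⊕ c) ⊖ c)
      ≡⟨ toℕ-⊖ (a ⊕ c) c ⟩
    (toℕ (a ⊕ c) + (n ∸ toℕ c)) % n
      ≡⟨ cong (λ z → (z + (n ∸ toℕ c)) % n) (toℕ-⊕ a c) ⟩
    ((toℕ a + toℕ c) % n + (n ∸ toℕ c)) % n
      ≡⟨ [m%d+n]%d≡[m+n]%d (toℕ a + toℕ c) (n ∸ toℕ c) n ⟩
    (toℕ a + toℕ c + (n ∸ toℕ c)) % n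
      ≡⟨ cong (_% n) (+-assoc (toℕ a) (toℕ c) (n ∸ toℕ c)) ⟩
    (toℕ a + (toℕ c + (n ∸ toℕ c))) % n
      ≡⟨ cancel-n a _ (a+[n∸a]≡n c) ⟩
    toℕ a ∎)

  ⊕-comm : ∀ a b → a ⊕ b ≡ b ⊕ a
  ⊕-comm a b = toℕ-injective
    (trans (toℕ-⊕ a b) (trans (cong (_% n) (+-comm (toℕ a) (toℕ b))) (sym (toℕ-⊕ b a))))

  ⊖-involutive : ∀ v a → v ⊖ (v ⊖ a) ≡ a
  ⊖-involutive v a = begin
    v ⊖ (v ⊖ a)                  ≡⟨ cong (_⊖ (v ⊖ a)) (sym (⊖-⊕-cancel v a)) ⟩
    ((v ⊖ a) ⊕ a) ⊖ (v ⊖ a)      ≡⟨ cong (_⊖ (v ⊖ a)) (⊕-comm (v ⊖ a) a) ⟩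
    (a ⊕ (v ⊖ a)) ⊖ (v ⊖ a)      ≡⟨ ⊕-⊖-cancel a (v ⊖ a) ⟩
    a                            ∎

  ⊖-self : ∀ c → c ⊖ c ≡ 𝟘
  ⊖-self c = toℕ-injective
    (trans (toℕ-⊖ c c) (trans (cong (_% n) (a+[n∸a]≡n c)) (trans (n%n≡0 n) (sym toℕ-𝟘))))

  ⊖≡𝟘⇒≡ : ∀ v c → v ⊖ c ≡ 𝟘 → v ≡ c
  ⊖≡𝟘⇒≡ v c v⊖c≡𝟘 = begin
    v
      ≡⟨ ⊖-⊕-cancel v c ⟨
    (v ⊖ c) ⊕ c
      ≡⟨ cong (_⊕ c) v⊖c≡𝟘 ⟩
    𝟘 ⊕ c
      ≡⟨ toℕ-injective (trans (toℕ-⊕ 𝟘 c) (trans (cong (λ z → (z + toℕ c) % n) toℕ-𝟘) (toℕ%n c))) ⟩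
    c ∎

  translation : Fin n → Permutation′ n
  translation c = permutation (_⊕ c) (_⊖ c) (λ v → ⊖-⊕-cancel v c) (λ a → ⊕-⊖-cancel a c)

  module _ (S : Subset n) where

    inBall⇒ : ∀ c v → InBall n S c v → v ⊖ c ∈ S ∪ ⁅ 𝟘 ⁆
    inBall⇒ c v (inj₁ refl)   = x∈p∪q⁺ (inj₂ (subst (_∈ ⁅ 𝟘 ⁆) (sym (⊖-self c)) (x∈⁅x⁆ 𝟘)))
    inBall⇒ c v (inj₂ v⊖c∈S) = x∈p∪q⁺ (inj₁ v⊖c∈S)

    inBall⇐ : ∀ c v → v ⊖ c ∈ S ∪ ⁅ 𝟘 ⁆ → InBall n S c v
    inBall⇐ c v v⊖c∈A with x∈p∪q⁻ S ⁅ 𝟘 ⁆ v⊖c∈A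
    ... | inj₁ v⊖c∈S = inj₂ v⊖c∈S
    ... | inj₂ v⊖c∈0 = inj₁ (⊖≡𝟘⇒≡ v c (x∈⁅y⁆⇒x≡y 𝟘 v⊖c∈0))

  -- C tiles ℤ_n with A: every vertex v is c ⊕ a for exactly one c ∈ C (and then a = v ⊖ c ∈ A).
  Tiling : Subset n → Subset n → Set
  Tiling A C = ∀ v → Σ (Fin n) λ c → (c ∈ C × v ⊖ c ∈ A)
                                    × (∀ c′ → c′ ∈ C → v ⊖ c′ ∈ A → c′ ≡ c)

  perfectCode⇒tiling : ∀ S C → IsPerfectCode n S C → Tiling (S ∪ ⁅ 𝟘 ⁆) C
  perfectCode⇒tiling S C code v with code v
  ... | c , (c∈C , v∈ball) , unique =
    c , (c∈C , inBall⇒ S c v v∈ball) , λ c′ c′∈C v⊖c′∈A → unique c′ c′∈C (inBall⇐ S c′ v v⊖c′∈A)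

  tiling⇒perfectCode : ∀ S C → Tiling (S ∪ ⁅ 𝟘 ⁆) C → IsPerfectCode n S C
  tiling⇒perfectCode S C tiling v with tiling v
  ... | c , (c∈C , v⊖c∈A) , unique =
    c , (c∈C , inBall⇐ S c v v⊖c∈A) , λ c′ c′∈C v∈ball → unique c′ c′∈C (inBall⇒ S c′ v v∈ball)

module _ (K : ℕ) .{{_ : NonZero K}} where

  -- Equal remainders: the difference of the quotient parts is a multiple of K.
  %≡⇒∣∸ : ∀ a b → a % K ≡ b % K → K ∣ b ∸ a
  %≡⇒∣∸ a b a≡b = divides (b / K ∸ a / K) (begin
    b ∸ a
      ≡⟨ cong₂ _∸_ (m≡m%n+[m/n]*n b K) (m≡m%n+[m/n]*n a K) ⟩
    (b % K + b / K * K) ∸ (a % K + a / K * K)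
      ≡⟨ cong (λ r → (b % K + b / K * K) ∸ (r + a / K * K)) a≡b ⟩
    (b % K + b / K * K) ∸ (b % K + a / K * K)
      ≡⟨ [m+n]∸[m+o]≡n∸o (b % K) (b / K * K) (a / K * K) ⟩
    b / K * K ∸ a / K * K
      ≡⟨ *-distribʳ-∸ K (b / K) (a / K) ⟨
    (b / K ∸ a / K) * K ∎)

  ∣∸⇒%≡ : ∀ {a b} → a ≤ b → K ∣ b ∸ a → a % K ≡ b % K
  ∣∸⇒%≡ {a} a≤b K∣b∸a = sym (trans (cong (_% K) (sym (m+[n∸m]≡n a≤b))) (%-remove-+ʳ a K∣b∸a))

  ∣+a-+b∣≡b∸a : ∀ {a b} → a ≤ b → ℤ.∣ ℤ.+ a ℤ.- ℤ.+ b ∣ ≡ b ∸ a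
  ∣+a-+b∣≡b∸a {a} {b} a≤b = trans (cong ℤ.∣_∣ (m-n≡m⊖n a b)) (∣⊖∣-≤ a≤b)

  ∣+a-+b∣≡a∸b : ∀ {a b} → b ≤ a → ℤ.∣ ℤ.+ a ℤ.- ℤ.+ b ∣ ≡ a ∸ b
  ∣+a-+b∣≡a∸b {a} {b} b≤a =
    trans (cong ℤ.∣_∣ (m-n≡m⊖n a b)) (trans (∣m⊖n∣≡∣n⊖m∣ a b) (∣⊖∣-≤ b≤a))

  ≡[mod]⇔%≡ : ∀ a b → a ≡ b [mod K ] ⇔ a % K ≡ b % K
  ≡[mod]⇔%≡ a b = mk⇔ to from
    where
    to : a ≡ b [mod K ] → a % K ≡ b % K
    to K∣a-b with ≤-total a b
    ... | inj₁ a≤b = ∣∸⇒%≡ a≤b (subst (K ∣_) (∣+a-+b∣≡b∸a a≤b) K∣a-b)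
    ... | inj₂ b≤a = sym (∣∸⇒%≡ b≤a (subst (K ∣_) (∣+a-+b∣≡a∸b b≤a) K∣a-b))
    from : a % K ≡ b % K → a ≡ b [mod K ]
    from a≡b with ≤-total a b
    ... | inj₁ a≤b = subst (K ∣_) (sym (∣+a-+b∣≡b∸a a≤b)) (%≡⇒∣∸ a b a≡b)
    ... | inj₂ b≤a = subst (K ∣_) (sym (∣+a-+b∣≡a∸b b≤a)) (%≡⇒∣∸ b a (sym a≡b))

Incongruent : ∀ {n} → ℕ → Subset n → Set
Incongruent q A = ∀ s s′ → s ∈ A → s′ ∈ A → s ≢ s′ → ¬ (toℕ s ≡ toℕ s′ [mod q ])

module Tilings (n K-1 m : ℕ) .{{_ : NonZero n}} (n≡m*K : n ≡ m * suc K-1) where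

  open Residues K-1
  open Walks K-1
  open CyclicGroup n

  -- Since K ∣ n, residues modulo K are well defined on ℤ_n.
  n≋0 : n ≋ 0
  n≋0 = trans (cong (_% K) n≡m*K) (m*n%n≡0 m K)

  x%n≋x : ∀ x → x % n ≋ x
  x%n≋x x = m∣n⇒o%n%m≡o%m K n x (divides m n≡m*K)

  toℕ-⊕≋ : ∀ a b → toℕ (a ⊕ b) ≋ toℕ a + toℕ b
  toℕ-⊕≋ a b = trans (cong (_% K) (toℕ-⊕ a b)) (x%n≋x _)

  toℕ-⊖≋ : ∀ v a → toℕ (v ⊖ a) ≋ toℕ v + (n ∸ toℕ a)
  toℕ-⊖≋ v a = trans (cong (_% K) (toℕ-⊖ v a)) (x%n≋x _)

  n∸a≋0 : ∀ a → toℕ a ≋ 0 → n ∸ toℕ a ≋ 0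
  n∸a≋0 a a≋0 =
    trans (sym (≋0-+ (toℕ a) (n ∸ toℕ a) a≋0)) (trans (cong (_% K) (a+[n∸a]≡n a)) n≋0)

  module _ (A : Subset n) (|A|≡K : ∣ A ∣ ≡ K) where

    𝟙A : Fin n → ℕ
    𝟙A a = 𝟙 (a ∈? A)

    ∑𝟙A≡K : sum 𝟙A ≡ K
    ∑𝟙A≡K = trans (∑𝟙≡∣∣ A) |A|≡K

    -- classSize r is the number of elements of A in the residue class −r modulo K.
    classSize : Fin K → ℕ
    classSize r = sum (λ a → 𝟙A a * δ (toℕ r + toℕ a))

    -- Each element of A lies in exactly one class.
    ∑classSize≡K : sum classSize ≡ K
    ∑classSize≡K = begin
      sum {K} (λ r → sum {n} (λ a → 𝟙A a * δ (toℕ r + toℕ a)))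
        ≡⟨ ∑-comm {K} {n} (λ r a → 𝟙A a * δ (toℕ r + toℕ a)) ⟩
      sum {n} (λ a → sum {K} (λ r → 𝟙A a * δ (toℕ r + toℕ a)))
        ≡⟨ sum-cong-≗ {n} (λ a → sym (*-distribˡ-sum {K} (𝟙A a) (λ r → δ (toℕ r + toℕ a)))) ⟩
      sum {n} (λ a → 𝟙A a * ∑< K (λ r → δ (r + toℕ a)))
        ≡⟨ sum-cong-≗ {n} (λ a → trans (cong (𝟙A a *_) (one-per-class a)) (*-identityʳ (𝟙A a))) ⟩
      sum 𝟙A
        ≡⟨ ∑𝟙A≡K ⟩
      K ∎
      where
      one-per-class : ∀ a → ∑< K (λ r → δ (r + toℕ a)) ≡ 1
      one-per-class a = trans (∑<-cong K (λ r _ → cong δ (+-comm r (toℕ a)))) (δ-window (toℕ a))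

    classSize-of : ∀ a a′ → a ∈ A → a′ ∈ A → a ≢ a′ → toℕ a ≋ toℕ a′ → 2 ≤ classSize -[ toℕ a ]
    classSize-of a a′ a∈A a′∈A a≢a′ a≋a′ =
      subst₂ (λ x y → x + y ≤ classSize r)
             (in-class a a∈A refl) (in-class a′ a′∈A (sym a≋a′)) (pair≤sum _ a≢a′)
      where
      r : Fin K
      r = -[ toℕ a ]
      in-class : ∀ b → b ∈ A → toℕ b ≋ toℕ a → 𝟙A b * δ (toℕ r + toℕ b) ≡ 1
      in-class b b∈A b≋a =
        𝟙*𝟙≡1 (b ∈? A) ((toℕ r + toℕ b) % K ≟ 0) b∈A (y≋x⇒-[x]+y≋0 (toℕ a) (toℕ b) b≋a)

    incongruent⇒classSize≤1 : Incongruent K A → ∀ r → classSize r ≤ 1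
    incongruent⇒classSize≤1 incongruent r with 0 <? classSize r
    ... | no  size≯0 = ≤-trans (≮⇒≥ size≯0) z≤n
    ... | yes size>0 with sum-positive _ size>0
    ...   | a , term>0 with 𝟙*𝟙-pos (a ∈? A) ((toℕ r + toℕ a) % K ≟ 0) term>0
    ...     | a∈A , r+a≋0 =
      ≤-trans (≤-reflexive (sum-concentrated _ a others-vanish)) (𝟙*𝟙≤1 (a ∈? A) ((toℕ r + toℕ a) % K ≟ 0))
      where
      others-vanish : ∀ a′ → a′ ≢ a → 𝟙A a′ * δ (toℕ r + toℕ a′) ≡ 0
      others-vanish a′ a′≢a = 𝟙*𝟙≡0 (a′ ∈? A) ((toℕ r + toℕ a′) % K ≟ 0) λ a′∈A r+a′≋0 →
        incongruent a′ a a′∈A a∈A a′≢a (Equivalence.from (≡[mod]⇔%≡ K (toℕ a′) (toℕ a))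
          (≋-cancelˡ (toℕ r) (toℕ a′) (toℕ a) (trans r+a′≋0 (sym r+a≋0))))

    -- With K classes and K elements, no class is empty.
    incongruent⇒classSize≥1 : Incongruent K A → ∀ r → 1 ≤ classSize r
    incongruent⇒classSize≥1 incongruent =
      sum≡N∧≤1⇒≥1 classSize ∑classSize≡K (incongruent⇒classSize≤1 incongruent)

    multiplesOfK : Subset n
    multiplesOfK = tabulate (λ v → does (toℕ v % K ≟ 0))

    ∈multiplesOfK⇒ : ∀ v → v ∈ multiplesOfK → toℕ v ≋ 0
    ∈multiplesOfK⇒ v v∈ =
      does≡true⇒ (toℕ v % K ≟ 0) (trans (sym (lookup∘tabulate _ v)) ([]=⇒lookup v∈))

    ⇒∈multiplesOfK : ∀ v → toℕ v ≋ 0 → v ∈ multiplesOfK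
    ⇒∈multiplesOfK v v≋0 =
      lookup⇒[]= v multiplesOfK (trans (lookup∘tabulate _ v) (dec-true (toℕ v % K ≟ 0) v≋0))

    -- For v, the
    -- class of v contains some a ∈ A; then v = c ⊕ a with c = v ⊖ a ≡ 0, and c is unique by incongruence.
    incongruent⇒tiling : Incongruent K A → Tiling A multiplesOfK
    incongruent⇒tiling incongruent v with sum-positive _ (incongruent⇒classSize≥1 incongruent -[ toℕ v ])
    ... | a , term>0 with 𝟙*𝟙-pos (a ∈? A) ((toℕ -[ toℕ v ] + toℕ a) % K ≟ 0) term>0
    ...   | a∈A , r+a≋0 = v ⊖ a , (c∈ , subst (_∈ A) (sym (⊖-involutive v a)) a∈A) , unique
      where
      a≋v : toℕ a ≋ toℕ v
      a≋v = -[x]+y≋0⇒y≋x (toℕ v) (toℕ a) r+a≋0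
      c∈ : v ⊖ a ∈ multiplesOfK
      c∈ = ⇒∈multiplesOfK (v ⊖ a) (begin
        toℕ (v ⊖ a) % K
          ≡⟨ toℕ-⊖≋ v a ⟩
        (toℕ v + (n ∸ toℕ a)) % K
          ≡⟨ ≋-+ʳ (toℕ v) (toℕ a) (n ∸ toℕ a) (sym a≋v) ⟩
        (toℕ a + (n ∸ toℕ a)) % K
          ≡⟨ cong (_% K) (a+[n∸a]≡n a) ⟩
        n % K
          ≡⟨ n≋0 ⟩
        0 ∎)
      unique : ∀ c′ → c′ ∈ multiplesOfK → v ⊖ c′ ∈ A → c′ ≡ v ⊖ a
      unique c′ c′∈ v⊖c′∈A with v ⊖ c′ ≟ᶠ a
      ... | yes v⊖c′≡a = trans (sym (⊖-involutive v c′)) (cong (v ⊖_) v⊖c′≡a)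
      ... | no  v⊖c′≢a = ⊥-elim (incongruent (v ⊖ c′) a v⊖c′∈A a∈A v⊖c′≢a
        (Equivalence.from (≡[mod]⇔%≡ K (toℕ (v ⊖ c′)) (toℕ a)) (begin
        toℕ (v ⊖ c′) % K
          ≡⟨ toℕ-⊖≋ v c′ ⟩
        (toℕ v + (n ∸ toℕ c′)) % K
          ≡⟨ ≋-+ˡ (toℕ v) (n ∸ toℕ c′) 0 (n∸a≋0 c′ (∈multiplesOfK⇒ c′ c′∈)) ⟩
        (toℕ v + 0) % K
          ≡⟨ cong (_% K) (+-identityʳ (toℕ v)) ⟩
        toℕ v % K
          ≡⟨ a≋v ⟨
        toℕ a % K ∎)))

    module _ (C : Subset n) (tiling : Tiling A C) where

      𝟙C : Fin n → ℕ
      𝟙C c = 𝟙 (c ∈? C)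

      covered-once : ∀ v → sum (λ c → 𝟙C c * 𝟙A (v ⊖ c)) ≡ 1
      covered-once v with tiling v
      ... | c₀ , (c₀∈C , v⊖c₀∈A) , unique =
        trans (sum-concentrated _ c₀ others-vanish) (𝟙*𝟙≡1 (c₀ ∈? C) (v ⊖ c₀ ∈? A) c₀∈C v⊖c₀∈A)
        where
        others-vanish : ∀ c → c ≢ c₀ → 𝟙C c * 𝟙A (v ⊖ c) ≡ 0
        others-vanish c c≢c₀ = 𝟙*𝟙≡0 (c ∈? C) (v ⊖ c ∈? A) λ c∈C v⊖c∈A → c≢c₀ (unique c c∈C v⊖c∈A)

      -- A K-periodic function summed over ℤ_n equals its sum over the pairs (a, c) ∈ A × C: insert the
      -- covering count, exchange the sums, and translate v = a ⊕ c within each sum over c.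
      tiling-sum : ∀ h → Periodic h →
        sum (λ a → 𝟙A a * sum (λ c → 𝟙C c * h (toℕ a + toℕ c))) ≡ ∑< n h
      tiling-sum h h-per = sym (begin
        sum {n} (λ v → h (toℕ v))
          ≡⟨ sum-cong-≗ {n} (λ v → sym (trans (cong (_* h (toℕ v)) (covered-once v)) (+-identityʳ _))) ⟩
        sum {n} (λ v → sum {n} (λ c → 𝟙C c * 𝟙A (v ⊖ c)) * h (toℕ v))
          ≡⟨ sum-cong-≗ {n} (λ v → *-distribʳ-sum {n} (h (toℕ v)) (λ c → 𝟙C c * 𝟙A (v ⊖ c))) ⟩
        sum {n} (λ v → sum {n} (λ c → 𝟙C c * 𝟙A (v ⊖ c) * h (toℕ v)))
          ≡⟨ ∑-comm {n} {n} (λ v c → 𝟙C c * 𝟙A (v ⊖ c) * h (toℕ v)) ⟩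
        sum {n} (λ c → sum {n} (λ v → 𝟙C c * 𝟙A (v ⊖ c) * h (toℕ v)))
          ≡⟨ sum-cong-≗ {n} (λ c → ∑-permute _ (translation c)) ⟩
        sum {n} (λ c → sum {n} (λ a → 𝟙C c * 𝟙A ((a ⊕ c) ⊖ c) * h (toℕ (a ⊕ c))))
          ≡⟨ sum-cong-≗ {n} (λ c → sum-cong-≗ {n} (λ a → untranslate c a)) ⟩
        sum {n} (λ c → sum {n} (λ a → 𝟙A a * (𝟙C c * h (toℕ a + toℕ c))))
          ≡⟨ ∑-comm {n} {n} (λ c a → 𝟙A a * (𝟙C c * h (toℕ a + toℕ c))) ⟩
        sum {n} (λ a → sum {n} (λ c → 𝟙A a * (𝟙C c * h (toℕ a + toℕ c))))
          ≡⟨ sum-cong-≗ {n} (λ a → sym (*-distribˡ-sum {n} (𝟙A a) (λ c → 𝟙C c * h (toℕ a + toℕ c)))) ⟩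
        sum {n} (λ a → 𝟙A a * sum {n} (λ c → 𝟙C c * h (toℕ a + toℕ c))) ∎)
        where
        untranslate : ∀ c a →
          𝟙C c * 𝟙A ((a ⊕ c) ⊖ c) * h (toℕ (a ⊕ c)) ≡ 𝟙A a * (𝟙C c * h (toℕ a + toℕ c))
        untranslate c a = begin
          𝟙C c * 𝟙A ((a ⊕ c) ⊖ c) * h (toℕ (a ⊕ c))
            ≡⟨ cong₂ (λ x y → 𝟙C c * 𝟙A x * y) (⊕-⊖-cancel a c) (h-per _ _ (toℕ-⊕≋ a c)) ⟩
          𝟙C c * 𝟙A a * h (toℕ a + toℕ c)
            ≡⟨ cong (_* h (toℕ a + toℕ c)) (*-comm (𝟙C c) (𝟙A a)) ⟩
          𝟙A a * 𝟙C c * h (toℕ a + toℕ c)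
            ≡⟨ *-assoc (𝟙A a) (𝟙C c) _ ⟩
          𝟙A a * (𝟙C c * h (toℕ a + toℕ c)) ∎

      -- The K translates of C, indexed by A, partition ℤ_n, so |C| · K = n.
      |C|≡m : ∣ C ∣ ≡ m
      |C|≡m = *-cancelʳ-≡ ∣ C ∣ m K (begin
        ∣ C ∣ * K                                   ≡⟨ *-comm ∣ C ∣ K ⟩
        K * ∣ C ∣                                   ≡⟨ cong (_* ∣ C ∣) ∑𝟙A≡K ⟨
        sum 𝟙A * ∣ C ∣                              ≡⟨ *-distribʳ-sum {n} ∣ C ∣ 𝟙A ⟩
        sum {n} (λ a → 𝟙A a * ∣ C ∣)                ≡⟨ sum-cong-≗ {n} (λ a → cong (𝟙A a *_) |C|≡∑𝟙C) ⟩
        sum (λ a → 𝟙A a * sum {n} (λ c → 𝟙C c * 1)) ≡⟨ tiling-sum (λ _ → 1) (λ _ _ _ → refl) ⟩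
        sum {n} (λ _ → 1)                           ≡⟨ sum-const {n} 1 ⟩
        n * 1                                       ≡⟨ *-identityʳ n ⟩
        n                                           ≡⟨ n≡m*K ⟩
        m * K                                       ∎)
        where
        |C|≡∑𝟙C : ∣ C ∣ ≡ sum (λ c → 𝟙C c * 1)
        |C|≡∑𝟙C = sym (trans (sum-cong-≗ {n} (*-identityʳ ∘ 𝟙C)) (∑𝟙≡∣∣ C))

      codewords : List ℕ
      codewords = memberValues C toℕ

      |codewords|≡m : length codewords ≡ m
      |codewords|≡m = trans (length-memberValues C toℕ) |C|≡m

      Q : Fin K → ℕ
      Q r = sum (λ a → 𝟙A a * walks codewords K (toℕ r + toℕ a))

      -- Exactly: a + c₁ runs once over ℤ_n = A ⊕ C, and then (c₂, …, c_K) is unconstrained in the window.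
      Q≡mᴷ : ∀ r → Q r ≡ m * m ^ K-1
      Q≡mᴷ r = begin
        Q r
          ≡⟨ sum-cong-≗ {n} (λ a → cong (𝟙A a *_) (first-step a)) ⟩
        sum (λ a → 𝟙A a * sum {n} (λ c → 𝟙C c * h (toℕ a + toℕ c)))
          ≡⟨ tiling-sum h h-periodic ⟩
        ∑< n h
          ≡⟨ cong (λ N → ∑< N h) n≡m*K ⟩
        ∑< (m * K) h
          ≡⟨ ∑<-periods h h-periodic m ⟩
        m * ∑< K h
          ≡⟨ cong (m *_) (walks-total codewords K-1 (toℕ r)) ⟩
        m * length codewords ^ K-1
          ≡⟨ cong (λ z → m * z ^ K-1) |codewords|≡m ⟩
        m * m ^ K-1 ∎
        where
        h : ℕ → ℕ
        h y = walks codewords K-1 (toℕ r + y)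
        h-periodic : Periodic h
        h-periodic x y x≋y =
          walks-periodic codewords K-1 (toℕ r + x) (toℕ r + y) (≋-+ˡ (toℕ r) x y x≋y)
        first-step : ∀ a → walks codewords K (toℕ r + toℕ a) ≡ sum (λ c → 𝟙C c * h (toℕ a + toℕ c))
        first-step a = trans
          (sumL-memberValues C toℕ (λ c → walks codewords K-1 ((toℕ r + toℕ a) + c)))
          (sum-cong-≗ {n} λ c → cong (λ z → 𝟙C c * walks codewords K-1 z) (+-assoc (toℕ r) (toℕ a) (toℕ c)))

      module _ {p : ℕ} (p-prime : Prime p) (p∣KCj : ∀ j → 0 < j → j < K → p ∣ K choose j) (p∤m : ¬ p ∣ m)
        where

        private instance
          p≢0 : NonZero p
          p≢0 = prime⇒nonZero p-prime

        -- Modulo p the K-fold sum over C collapses (Frobenius), so Q r ≡ m · classSize r.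
        Q≡m*classSize : ∀ r → Q r % p ≡ (m * classSize r) % p
        Q≡m*classSize r = trans (sum-%-cong p _ _ frobenius-term) (cong (_% p) pull-out-m)
          where
          frobenius-term : ∀ a → (𝟙A a * walks codewords K (toℕ r + toℕ a)) % p
                               ≡ (𝟙A a * (m * δ (toℕ r + toℕ a))) % p
          frobenius-term a = begin
            (𝟙A a * walks codewords K x) % p
              ≡⟨ %-distribˡ-* (𝟙A a) _ p ⟩
            (𝟙A a % p * (walks codewords K x % p)) % p
              ≡⟨ cong (λ z → (𝟙A a % p * z) % p) (walks-frobenius p∣KCj codewords x) ⟩
            (𝟙A a % p * ((length codewords * δ x) % p)) % p
              ≡⟨ %-distribˡ-* (𝟙A a) (length codewords * δ x) p ⟨
            (𝟙A a * (length codewords * δ x)) % p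
              ≡⟨ cong (λ z → (𝟙A a * (z * δ x)) % p) |codewords|≡m ⟩
            (𝟙A a * (m * δ x)) % p ∎
            where
            x : ℕ
            x = toℕ r + toℕ a
          pull-out-m : sum (λ a → 𝟙A a * (m * δ (toℕ r + toℕ a))) ≡ m * classSize r
          pull-out-m = trans (sum-cong-≗ {n} (λ a → m*[n*o]≡n*[m*o] (𝟙A a) m _))
                             (sym (*-distribˡ-sum {n} m (λ a → 𝟙A a * δ (toℕ r + toℕ a))))

        -- An empty class would give p ∣ m · m^(K−1), hence p ∣ m.
        tiling⇒classSize≥1 : ∀ r → 1 ≤ classSize r
        tiling⇒classSize≥1 r = n≢0⇒n>0 λ classSize≡0 →
          p∤m (p∣mᵏ⁺¹⇒p∣m p-prime K-1 (m%n≡0⇒n∣m _ p (begin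
            (m * m ^ K-1) % p        ≡⟨ cong (_% p) (Q≡mᴷ r) ⟨
            Q r % p                  ≡⟨ Q≡m*classSize r ⟩
            (m * classSize r) % p    ≡⟨ cong (λ z → (m * z) % p) classSize≡0 ⟩
            (m * 0) % p              ≡⟨ cong (_% p) (*-zeroʳ m) ⟩
            0 % p                    ≡⟨ m<n⇒m%n≡m (>-nonZero⁻¹ p) ⟩
            0                        ∎)))

        -- With K classes and K elements, every class holds exactly one element of A.
        tiling⇒incongruent : Incongruent K A
        tiling⇒incongruent a a′ a∈A a′∈A a≢a′ a≡a′ =
          <⇒≱ (classSize-of a a′ a∈A a′∈A a≢a′ (Equivalence.to (≡[mod]⇔%≡ K (toℕ a) (toℕ a′)) a≡a′))
              (sum≡N∧≥1⇒≤1 classSize ∑classSize≡K tiling⇒classSize≥1 -[ toℕ a ])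

theorem1p2 : (n l p : ℕ) .{{_ : NonZero n}} → 0 < l → Prime p
    → (p ^ l) ∣ n → ¬ ((p ^ (l + 1)) ∣ n)
    → (S : Subset n) → 0ₙ n ∉ S → (∀ s → s ∈ S → (-ₙ_ n s) ∈ S)
    → ∣ S ∣ ≡ p ^ l ∸ 1 → Connected n S
    → HasPerfectCode n S
      ⇔ (∀ s s' → s ∈ (S ∪ ⁅ 0ₙ n ⁆) → s' ∈ (S ∪ ⁅ 0ₙ n ⁆) → s ≢ s'
           → ¬ (toℕ s ≡ toℕ s' [mod (p ^ l) ]))
theorem1p2 n l p _ p-prime (divides m n≡m*pˡ) pˡ⁺¹∤n S 0∉S _ |S|≡pˡ-1 _ = mk⇔
  (λ (C , code) → subst (λ q → Incongruent q A) K≡pˡ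
    (tiling⇒incongruent A |A|≡K C (perfectCode⇒tiling S C code) p-prime p∣Kchoosej p∤m))
  (λ incongruent → multiplesOfK A |A|≡K , tiling⇒perfectCode S _
    (incongruent⇒tiling A |A|≡K (subst (λ q → Incongruent q A) (sym K≡pˡ) incongruent)))
  where
  instance
    p≢0 : NonZero p
    p≢0 = prime⇒nonZero p-prime
  K-1 : ℕ
  K-1 = p ^ l ∸ 1
  K≡pˡ : suc K-1 ≡ p ^ l
  K≡pˡ = m+[n∸m]≡n (m^n>0 p l)
  open Tilings n K-1 m (trans n≡m*pˡ (cong (m *_) (sym K≡pˡ)))
  open CyclicGroup n using (perfectCode⇒tiling; tiling⇒perfectCode)
  A : Subset n
  A = S ∪ ⁅ 0ₙ n ⁆
  |A|≡K : ∣ A ∣ ≡ suc K-1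
  |A|≡K = trans (∣p∪⁅x⁆∣ S (0ₙ n) 0∉S) (cong suc |S|≡pˡ-1)
  p∤m : ¬ p ∣ m
  p∤m = p∤cofactor l n≡m*pˡ pˡ⁺¹∤n
  p∣Kchoosej : ∀ j → 0 < j → j < suc K-1 → p ∣ suc K-1 choose j
  p∣Kchoosej j 0<j j<K = subst (λ q → p ∣ q choose j) (sym K≡pˡ) (p∣pˡCj p-prime l j 0<j (subst (j <_) K≡pˡ j<K))
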